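{- Let $G=(V,E)$ be a finite simple graph with a maximal adjacency ordering $<$, with vertices identified with $1,\dots,n$ according to $<$. Let $s>1$ be a vertex and $k$ a positive integer at most the number of neighbours of $s$ in $\{1,\dots,s-1\}$. For $i\in\{1,\dots,k\}$ let $T_i$ be the connected component of the forest $(V,F_i)$ containing $s$ and $r_i$ its smallest vertex. Let $1\le i<j\le k$ and let $v$ be a vertex with $r_j<v<s$. Then $v$ is a vertex of both $T_j$ and $T_i$, and $$r_i\le \mathrm{left}_i(v)<\mathrm{left}_j(v)<v \quad\text{and}\quad r_j\le \mathrm{left}_j(v).$$
   Context: A maximal adjacency ordering (MAO) of $G$ is a total order $1,\dots,n$ on $V$ such that for every two vertices $v<w$, the number of neighbours of $v$ in $\{1,\dots,v-1\}$ is at least the number of neighbours of $w$ in $\{1,\dots,v-1\}$. Forest decomposition: for each vertex $v>1$ with neighbours $w_1<\dots<w_l$ in $\{1,\dots,v-1\}$, the edge $\{w_i,v\}$ is put into the edge set $F_i$ for $i=1,\dots,l$; each $(V,F_i)$ is a forest. For a vertex $v$, $\mathrm{left}_i(v)$ denotes the unique vertex $w<v$ such that $\{w,v\}\in F_i$ (the $i$-th smallest neighbour of $v$ in $\{1,\dots,v-1\}$). -}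

module Defs where

open import Data.Nat using (ℕ; zero; suc; _∸_; _≤_; _<_)
open import Data.Bool using (Bool; true; false)
open import Data.List using (List; []; _∷_; length; map; upTo; filterᵇ)
open import Data.Maybe using (Maybe; just; nothing)
open import Data.Product using (_×_)
open import Data.Sum using (_⊎_)
open import Relation.Binary.PropositionalEquality using (_≡_)

record SimpleGraph (n : ℕ) : Set where
  field
    E       : ℕ → ℕ → Bool
    sym     : ∀ u v → E u v ≡ E v u
    irrefl  : ∀ v → E v v ≡ false
    inV     : ∀ u v → E u v ≡ true → (1 ≤ u × u ≤ n)
open SimpleGraph public

below : ℕ → List ℕ
below m = map suc (upTo (m ∸ 1))

nbrsBelow : ∀ {n} → SimpleGraph n → ℕ → ℕ → List ℕ
nbrsBelow G m v = filterᵇ (λ w → E G w v) (below m)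

degBelow : ∀ {n} → SimpleGraph n → ℕ → ℕ → ℕ
degBelow G m v = length (nbrsBelow G m v)

-- Maximal adjacency ordering: the natural order 1,…,n of the vertices is an MAO.
IsMAO : ∀ {n} → SimpleGraph n → Set
IsMAO {n} G = ∀ v w → 1 ≤ v → v < w → w ≤ n → degBelow G v w ≤ degBelow G v v

nth : List ℕ → ℕ → Maybe ℕ
nth []       _       = nothing
nth (x ∷ xs) zero    = just x
nth (x ∷ xs) (suc k) = nth xs k

-- Left G i v w  :⇔  w = left_i(v), the i-th smallest (i ≥ 1) neighbour of v
-- in {1,…,v-1}.
Left : ∀ {n} → SimpleGraph n → ℕ → ℕ → ℕ → Set
Left G i v w = 1 ≤ i × nth (nbrsBelow G v v) (i ∸ 1) ≡ just w

FEdge : ∀ {n} → SimpleGraph n → ℕ → ℕ → ℕ → Set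
FEdge G i u v = Left G i v u ⊎ Left G i u v

data Reach {n} (G : SimpleGraph n) (i : ℕ) (x : ℕ) : ℕ → Set where
  here : Reach G i x x
  step : ∀ {y z} → Reach G i x y → FEdge G i y z → Reach G i x z

InT : ∀ {n} → SimpleGraph n → ℕ → ℕ → ℕ → Set
InT G i s v = Reach G i s v

IsRoot : ∀ {n} → SimpleGraph n → ℕ → ℕ → ℕ → Set
IsRoot G i s r = InT G i s r × (∀ v → InT G i s v → r ≤ v)

-- Two facts about an MAO drive the argument. First, if left_i(y) < u ≤ y then u
-- already has i left neighbours: y has i neighbours below u, and the MAO
-- condition at u says no later vertex has more of them than u itself. Hence if
-- v ≤ s has fewer than j left neighbours, no F_j-edge leads from a vertex ≥ v to
-- one below v, so T_j lies above v; as r_j ∈ T_j, every vertex in (r_j, s] has at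
-- least j > i left neighbours. Second, if w+1 has an i-th left neighbour a, the
-- same fact gives every vertex in (a, w] an i-th left neighbour, so by strong
-- induction on w the forest F_i connects w to w+1. Chaining these edges from v up
-- to s puts v into T_j and T_i; the inequalities are then read off the sorted
-- list of left neighbours of v.
module Submission where

open import Defs
open import Data.Bool using (Bool; T)
open import Data.Bool.Properties using (T-≡)
open import Data.List using (List; []; _∷_; _++_; length; map; upTo; applyUpTo; filterᵇ)
open import Data.List.Properties using (map-upTo; filter-++)
open import Data.List.Relation.Unary.All using (All; []; _∷_)
import Data.List.Relation.Unary.All.Properties as All
open import Data.List.Relation.Unary.AllPairs using (AllPairs; []; _∷_)
import Data.List.Relation.Unary.AllPairs.Properties as AllPairs
open import Data.Maybe using (just)
open import Data.Nat using (ℕ; zero; suc; _+_; _∸_; _≤_; _<_; _≤′_; ≤′-refl; ≤′-step; z≤n; s≤s; _≤?_)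
open import Data.Nat.Induction using (<-rec)
open import Data.Nat.Properties
open import Data.Product using (Σ; _×_; _,_; proj₂; ∃-syntax)
open import Data.Sum using (inj₁; inj₂)
open import Function using (_∘_; id)
open import Function.Bundles using (Equivalence)
open import Relation.Nullary using (yes; no; contradiction)
open import Relation.Nullary.Decidable using (T?)
open import Relation.Binary.PropositionalEquality as ≡ using (_≡_; refl; cong; subst; module ≡-Reasoning)

module _ {n} {G : SimpleGraph n} {i : ℕ} where

  FEdge-sym : ∀ {u v} → FEdge G i u v → FEdge G i v u
  FEdge-sym (inj₁ e) = inj₂ e
  FEdge-sym (inj₂ e) = inj₁ e

  Reach-trans : ∀ {x y z} → Reach G i x y → Reach G i y z → Reach G i x z
  Reach-trans p here       = p
  Reach-trans p (step q e) = step (Reach-trans p q) e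

  Reach-sym : ∀ {x y} → Reach G i x y → Reach G i y x
  Reach-sym here       = here
  Reach-sym (step p e) = Reach-trans (step here (FEdge-sym e)) (Reach-sym p)

  Reach-interval : ∀ {a b} → (∀ {u} → a ≤ u → u < b → Reach G i u (suc u)) →
                   a ≤ b → Reach G i a b
  Reach-interval {a} link a≤b = go link (≤⇒≤′ a≤b)
    where
    go : ∀ {b} → (∀ {u} → a ≤ u → u < b → Reach G i u (suc u)) → a ≤′ b → Reach G i a b
    go link ≤′-refl          = here
    go link (≤′-step a≤′b) =
      Reach-trans (go (λ a≤u u<b → link a≤u (m<n⇒m<1+n u<b)) a≤′b) (link (≤′⇒≤ a≤′b) ≤-refl)

nth-All : ∀ {P : ℕ → Set} {xs} p {w} → All P xs → nth xs p ≡ just w → P w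
nth-All zero    (px ∷ _)   refl = px
nth-All (suc p) (_  ∷ pxs) eq   = nth-All p pxs eq

nth-just : ∀ xs p → p < length xs → ∃[ w ] nth xs p ≡ just w
nth-just (x ∷ xs) zero    _         = x , refl
nth-just (x ∷ xs) (suc p) (s≤s p<) = nth-just xs p p<

nth-strictMono : ∀ {xs} p q {a b} → AllPairs _<_ xs → p < q →
                 nth xs p ≡ just a → nth xs q ≡ just b → a < b
nth-strictMono zero    (suc q) (x< ∷ _)  _         refl eq = nth-All q x< eq
nth-strictMono (suc p) (suc q) (_ ∷ xs<) (s≤s p<q) eqa  eqb = nth-strictMono p q xs< p<q eqa eqb

nth-++-below : ∀ xs {ys} p {v w} → All (v ≤_) ys → w < v →
               nth (xs ++ ys) p ≡ just w → p < length xs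
nth-++-below []       p       ys≥v w<v eq = contradiction (nth-All p ys≥v eq) (<⇒≱ w<v)
nth-++-below (x ∷ xs) zero    _    _   _  = s≤s z≤n
nth-++-below (x ∷ xs) (suc p) ys≥v w<v eq = s≤s (nth-++-below xs p ys≥v w<v eq)

applyUpTo-++ : ∀ {A : Set} (f : ℕ → A) a b →
               applyUpTo f (a + b) ≡ applyUpTo f a ++ applyUpTo (f ∘ (a +_)) b
applyUpTo-++ f zero    b = refl
applyUpTo-++ f (suc a) b = cong (f 0 ∷_) (applyUpTo-++ (f ∘ suc) a b)

below-< : ∀ m → All (_< m) (below m)
below-< zero    = []
below-< (suc m) = All.map⁺ (All.applyUpTo⁺₁ id m s≤s)

below-sorted : ∀ m → AllPairs _<_ (below m)
below-sorted m = AllPairs.map⁺ (AllPairs.applyUpTo⁺₁ id (m ∸ 1) (λ i<j _ → s≤s i<j))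

below-++ : ∀ {v y} → v ≤ y →
           below (suc y) ≡ below (suc v) ++ applyUpTo (suc ∘ (v +_)) (y ∸ v)
below-++ {v} {y} v≤y = begin
  map suc (upTo y)                               ≡⟨ map-upTo suc y ⟩
  applyUpTo suc y                                ≡⟨ cong (applyUpTo suc) (≡.sym (m+[n∸m]≡n v≤y)) ⟩
  applyUpTo suc (v + (y ∸ v))                    ≡⟨ applyUpTo-++ suc v (y ∸ v) ⟩
  applyUpTo suc v ++ applyUpTo (suc ∘ (v +_)) (y ∸ v)
    ≡⟨ cong (_++ applyUpTo (suc ∘ (v +_)) (y ∸ v)) (≡.sym (map-upTo suc v)) ⟩
  map suc (upTo v) ++ applyUpTo (suc ∘ (v +_)) (y ∸ v) ∎
  where open ≡-Reasoning

module LeftNeighbours {n} (G : SimpleGraph n) where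

  nbrsBelow-sorted : ∀ m v → AllPairs _<_ (nbrsBelow G m v)
  nbrsBelow-sorted m v = AllPairs.filter⁺ (T? ∘ λ w → E G w v) (below-sorted m)

  Left⇒< : ∀ i v {w} → Left G i v w → w < v
  Left⇒< i v (_ , eq) = nth-All (i ∸ 1) (All.filter⁺ (T? ∘ λ w → E G w v) (below-< v)) eq

  Left⇒≤n : ∀ i v {w} → Left G i v w → v ≤ n
  Left⇒≤n i v {w} (_ , eq) = proj₂ (inV G v w (≡.trans (SimpleGraph.sym G v w) (Equivalence.to T-≡ adj)))
    where
    adj : T (E G w v)
    adj = nth-All (i ∸ 1) (All.all-filter (T? ∘ λ w → E G w v) (below v)) eq

  Left-strictMono : ∀ {i j} v {a b} → i < j → Left G i v a → Left G j v b → a < b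
  Left-strictMono {suc i} {suc j} v (s≤s i<j) (_ , eqa) (_ , eqb) =
    nth-strictMono i j (nbrsBelow-sorted v v) i<j eqa eqb

  Left-exists : ∀ {i} v → 1 ≤ i → i ≤ degBelow G v v → ∃[ w ] Left G i v w
  Left-exists {suc i} v 1≤i i≤deg with nth-just (nbrsBelow G v v) i i≤deg
  ... | w , eq = w , 1≤i , eq

  Left⇒≤degBelow : ∀ j y {l v} → Left G j y l → l < v → v ≤ y → j ≤ degBelow G v y
  Left⇒≤degBelow (suc j) (suc y) {l} {suc v} (_ , eq) l<v (s≤s v≤y) =
    nth-++-below (filterᵇ adj (below (suc v))) j rest≥v l<v eq′
    where
    adj : ℕ → Bool
    adj w = E G w (suc y)
    rest : List ℕ
    rest = applyUpTo (suc ∘ (v +_)) (y ∸ v)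
    rest≥v : All (suc v ≤_) (filterᵇ adj rest)
    rest≥v = All.filter⁺ (T? ∘ adj) (All.applyUpTo⁺₂ _ (y ∸ v) (λ x → s≤s (m≤m+n v x)))
    eq′ : nth (filterᵇ adj (below (suc v)) ++ filterᵇ adj rest) j ≡ just l
    eq′ = subst (λ xs → nth xs j ≡ just l)
            (≡.trans (cong (filterᵇ adj) (below-++ v≤y)) (filter-++ (T? ∘ adj) (below (suc v)) rest))
            eq

module MAO {n} (G : SimpleGraph n) (mao : IsMAO G) where

  open LeftNeighbours G

  Left⇒≤degree : ∀ j y {l u} → Left G j y l → l < u → u ≤ y → j ≤ degBelow G u u
  Left⇒≤degree j y L l<u u≤y with m≤n⇒m<n∨m≡n u≤y
  ... | inj₁ u<y  = ≤-trans (Left⇒≤degBelow j y L l<u u≤y)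
                            (mao _ y (≤-trans (s≤s z≤n) l<u) u<y (Left⇒≤n j y L))
  ... | inj₂ refl = Left⇒≤degBelow j y L l<u ≤-refl

  Reach-suc : ∀ {i} w → 1 ≤ i → i ≤ degBelow G (suc w) (suc w) → Reach G i w (suc w)
  Reach-suc {i} w 1≤i = <-rec (λ w → i ≤ degBelow G (suc w) (suc w) → Reach G i w (suc w)) edge w
    where
    edge : ∀ w → (∀ {u} → u < w → i ≤ degBelow G (suc u) (suc u) → Reach G i u (suc u)) →
           i ≤ degBelow G (suc w) (suc w) → Reach G i w (suc w)
    edge w rec i≤deg with Left-exists (suc w) 1≤i i≤deg
    ... | a , L = Reach-trans (Reach-sym (Reach-interval link (≤-pred (Left⇒< i (suc w) L)))) (step here (inj₁ L))
      where
      link : ∀ {u} → a ≤ u → u < w → Reach G i u (suc u)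
      link a≤u u<w = rec u<w (Left⇒≤degree i (suc w) L (s≤s a≤u) (m<n⇒m<1+n u<w))

  Reach-≥ : ∀ {j v s y} → degBelow G v v < j → v ≤ s → Reach G j s y → v ≤ y
  Reach-≥ deg<j v≤s here                = v≤s
  Reach-≥ {j} deg<j v≤s (step {y} {z} p (inj₁ L)) =
    ≤-trans (Reach-≥ deg<j v≤s p) (<⇒≤ (Left⇒< j z L))
  Reach-≥ {j} {v} deg<j v≤s (step {y} {z} p (inj₂ L)) with v ≤? z
  ... | yes v≤z = v≤z
  ... | no  v≰z = contradiction (Left⇒≤degree j y L (≰⇒> v≰z) (Reach-≥ deg<j v≤s p)) (<⇒≱ deg<j)

  IsRoot⇒≤degree : ∀ {j s r y} → IsRoot G j s r → r < y → y ≤ s → j ≤ degBelow G y y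
  IsRoot⇒≤degree {j} {y = y} (r∈T , _) r<y y≤s with j ≤? degBelow G y y
  ... | yes j≤deg = j≤deg
  ... | no  j≰deg = contradiction (Reach-≥ (≰⇒> j≰deg) y≤s r∈T) (<⇒≱ r<y)

  IsRoot⇒InT : ∀ {i j s r y} → IsRoot G j s r → 1 ≤ i → i ≤ j → r ≤ y → y ≤ s → InT G i s y
  IsRoot⇒InT {i} {s = s} {y = y} root 1≤i i≤j r≤y y≤s = Reach-sym (Reach-interval link y≤s)
    where
    link : ∀ {u} → y ≤ u → u < s → Reach G i u (suc u)
    link {u} y≤u u<s = Reach-suc u 1≤i (≤-trans i≤j (IsRoot⇒≤degree root (s≤s (≤-trans r≤y y≤u)) u<s))

corollary1 : ∀ {n} (G : SimpleGraph n) → IsMAO G →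
    ∀ (s k : ℕ) → 1 < s → s ≤ n → 1 ≤ k → k ≤ degBelow G s s →
    ∀ (i j ri rj : ℕ) → 1 ≤ i → i < j → j ≤ k →
    IsRoot G i s ri → IsRoot G j s rj →
    ∀ (v : ℕ) → rj < v → v < s →
    InT G j s v × InT G i s v ×
    (∃[ li ] ∃[ lj ] (Left G i v li × Left G j v lj ×
    ri ≤ li × li < lj × lj < v × rj ≤ lj))
corollary1 G mao s _ _ _ _ _ i j ri rj 1≤i i<j _ rootᵢ rootⱼ v rj<v v<s =
  v∈Tⱼ , v∈Tᵢ , li , lj , Lᵢ , Lⱼ ,
  proj₂ rootᵢ li (step v∈Tᵢ (inj₂ Lᵢ)) , Left-strictMono v i<j Lᵢ Lⱼ , Left⇒< j v Lⱼ ,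
  proj₂ rootⱼ lj (step v∈Tⱼ (inj₂ Lⱼ))
  where
  open LeftNeighbours G
  open MAO G mao
  i≤j : i ≤ j
  i≤j = <⇒≤ i<j
  1≤j : 1 ≤ j
  1≤j = ≤-trans 1≤i i≤j
  j≤deg : j ≤ degBelow G v v
  j≤deg = IsRoot⇒≤degree rootⱼ rj<v (<⇒≤ v<s)
  v∈Tⱼ : InT G j s v
  v∈Tⱼ = IsRoot⇒InT rootⱼ 1≤j ≤-refl (<⇒≤ rj<v) (<⇒≤ v<s)
  v∈Tᵢ : InT G i s v
  v∈Tᵢ = IsRoot⇒InT rootⱼ 1≤i i≤j (<⇒≤ rj<v) (<⇒≤ v<s)
  leftᵢ : ∃[ w ] Left G i v w
  leftᵢ = Left-exists v 1≤i (≤-trans i≤j j≤deg)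
  leftⱼ : ∃[ w ] Left G j v w
  leftⱼ = Left-exists v 1≤j j≤deg
  open Σ leftᵢ renaming (proj₁ to li; proj₂ to Lᵢ)
  open Σ leftⱼ renaming (proj₁ to lj; proj₂ to Lⱼ)
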